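{- Let $n\ge 6$ and let $\mathcal F\subset\binom{[n]}{3}$ be an almost intersecting family with $\{1,2,3\},\{4,5,6\}\in\mathcal F$. For $1\le a\le 3$, $4\le b\le 6$ let $D(a,b)=\{c\in[7,n]:\{a,b,c\}\in\mathcal F\}$. If $|D(a,b)|\ge 2$ for some $1\le a\le 3$, $4\le b\le 6$, then no member of $\mathcal F$ is contained in $[6]\setminus\{a,b\}$.
   Context: $[7,n]=\{7,\dots,n\}$, $[6]=\{1,\dots,6\}$. A family $\mathcal F$ is almost intersecting if it is not intersecting (some two members are disjoint) but each $F\in\mathcal F$ is disjoint from at most one member of $\mathcal F$. -}

module Defs where

open import Data.Nat using (ℕ; _≤_; _<ᵇ_)
open import Data.Bool using (Bool; true; _∧_)
open import Data.Fin using (Fin; toℕ; inject≤; _↑ˡ_; _↑ʳ_)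
open import Data.Fin.Subset using (Subset; ⁅_⁆; _∪_; _∩_; _─_; _⊆_; ∣_∣; Empty)
open import Data.Vec using (tabulate)
open import Data.Product using (Σ; ∃; _×_)
open import Relation.Binary.PropositionalEquality using (_≡_)

-- Ground set [n] = {1,…,n} is modelled by Fin n: the point i ∈ [n] is the index i-1.
-- A family of subsets of [n] is given by its (decidable) membership predicate.
Family : ℕ → Set
Family n = Subset n → Bool

_∈F_ : ∀ {n} → Subset n → Family n → Set
S ∈F ℱ = ℱ S ≡ true

Uniform3 : ∀ {n} → Family n → Set
Uniform3 ℱ = ∀ S → S ∈F ℱ → ∣ S ∣ ≡ 3

Disjoint : ∀ {n} → Subset n → Subset n → Set
Disjoint S T = Empty (S ∩ T)

AlmostIntersecting : ∀ {n} → Family n → Set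
AlmostIntersecting ℱ =
  (Σ _ λ S → Σ _ λ T → S ∈F ℱ × T ∈F ℱ × Disjoint S T)
  × (∀ S T U → S ∈F ℱ → T ∈F ℱ → U ∈F ℱ → Disjoint S T → Disjoint S U → T ≡ U)

pt : ∀ {n} → 6 ≤ n → Fin 6 → Fin n
pt h k = inject≤ k h

-- a ∈ {1,2,3} given by a' : Fin 3 (a = a'+1); b ∈ {4,5,6} given by b' : Fin 3 (b = b'+4)
ptA : ∀ {n} → 6 ≤ n → Fin 3 → Fin n
ptA h a = pt h (a ↑ˡ 3)

ptB : ∀ {n} → 6 ≤ n → Fin 3 → Fin n
ptB h b = pt h (3 ↑ʳ b)

triple : ∀ {n} → Fin n → Fin n → Fin n → Subset n
triple x y z = ⁅ x ⁆ ∪ ⁅ y ⁆ ∪ ⁅ z ⁆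

A123 : ∀ {n} → 6 ≤ n → Subset n
A123 h = triple (ptA h Fin.zero) (ptA h (Fin.suc Fin.zero)) (ptA h (Fin.suc (Fin.suc Fin.zero)))
  where import Data.Fin as Fin

B456 : ∀ {n} → 6 ≤ n → Subset n
B456 h = triple (ptB h Fin.zero) (ptB h (Fin.suc Fin.zero)) (ptB h (Fin.suc (Fin.suc Fin.zero)))
  where import Data.Fin as Fin

six : ∀ {n} → Subset n
six = tabulate (λ i → toℕ i <ᵇ 6)

D : ∀ {n} → 6 ≤ n → Family n → Fin 3 → Fin 3 → Subset n
D h ℱ a b = tabulate (λ c → Data.Bool.not (toℕ c <ᵇ 6) ∧ ℱ (triple (ptA h a) (ptB h b) c))
  where import Data.Bool

sixMinus : ∀ {n} → 6 ≤ n → Fin 3 → Fin 3 → Subset n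
sixMinus h a b = six ─ (⁅ ptA h a ⁆ ∪ ⁅ ptB h b ⁆)

-- A member S ⊆ [6] ∖ {a,b} is disjoint from every {a,b,c} with c ∈ D(a,b),
-- since c ∉ [6]. These triples lie in ℱ and are distinct for distinct c, so
-- two elements of D(a,b) would give two members of ℱ disjoint from S.
module Submission where

open import Defs
open import Data.Nat using (ℕ; _≤_; _<_; _<ᵇ_; s≤s)
open import Data.Nat.Properties using (<⇒<ᵇ)
open import Data.Bool using (Bool; true; false)
open import Data.Bool.Properties using (T-≡)
open import Data.Fin using (Fin; toℕ; zero; suc)
open import Data.Fin.Properties using (toℕ<n; toℕ-inject≤; suc-injective)
open import Data.Fin.Subset using (Subset; _∈_; _∉_; _⊆_; ∣_∣; ⁅_⁆; _∪_; _─_; Nonempty; inside; outside)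
open import Data.Fin.Subset.Properties using (x∈⁅x⁆; x∈⁅y⁆⇒x≡y; x∈p∩q⁻; x∈p∪q⁻; x∈p∪q⁺)
open import Data.Vec using (_∷_; tabulate; here; there)
open import Data.Vec.Properties using ([]=⇒lookup; lookup⇒[]=; lookup∘tabulate)
open import Data.Product using (∃₂; _×_; _,_)
open import Data.Sum using (_⊎_; inj₁; inj₂)
open import Function using (_∘_; Equivalence)
open import Relation.Nullary using (¬_; contradiction)
open import Relation.Binary.PropositionalEquality using (_≡_; _≢_; refl; sym; trans; subst)

private
  variable
    n : ℕ

1≤∣p∣⇒Nonempty : (p : Subset n) → 1 ≤ ∣ p ∣ → Nonempty p
1≤∣p∣⇒Nonempty (inside ∷ p) _ = zero , here
1≤∣p∣⇒Nonempty (outside ∷ p) 1≤∣p∣ with 1≤∣p∣⇒Nonempty p 1≤∣p∣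
... | x , x∈p = suc x , there x∈p

2≤∣p∣⇒distinct : (p : Subset n) → 2 ≤ ∣ p ∣ → ∃₂ λ x y → x ∈ p × y ∈ p × x ≢ y
2≤∣p∣⇒distinct (inside ∷ p) (s≤s 1≤∣p∣) with 1≤∣p∣⇒Nonempty p 1≤∣p∣
... | y , y∈p = zero , suc y , here , there y∈p , λ ()
2≤∣p∣⇒distinct (outside ∷ p) 2≤∣p∣ with 2≤∣p∣⇒distinct p 2≤∣p∣
... | x , y , x∈p , y∈p , x≢y = suc x , suc y , there x∈p , there y∈p , x≢y ∘ suc-injective

x∈tabulate⁻ : (f : Fin n → Bool) {x : Fin n} → x ∈ tabulate f → f x ≡ true
x∈tabulate⁻ f {x} x∈ = trans (sym (lookup∘tabulate f x)) ([]=⇒lookup x∈)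

x∈tabulate⁺ : (f : Fin n → Bool) {x : Fin n} → f x ≡ true → x ∈ tabulate f
x∈tabulate⁺ f {x} fx = lookup⇒[]= x (tabulate f) (trans (lookup∘tabulate f x) fx)

x∈p─q⁻ : (p q : Subset n) {x : Fin n} → x ∈ p ─ q → x ∈ p × x ∉ q
x∈p─q⁻ (inside ∷ p) (outside ∷ q) here = here , λ ()
x∈p─q⁻ (inside ∷ p) (inside ∷ q) {zero} ()
x∈p─q⁻ (outside ∷ p) (outside ∷ q) {zero} ()
x∈p─q⁻ (outside ∷ p) (inside ∷ q) {zero} ()
x∈p─q⁻ (_ ∷ p) (_ ∷ q) (there x∈) with x∈p─q⁻ p q x∈
... | x∈p , x∉q = there x∈p , λ { (there x∈q) → x∉q x∈q }

x∈triple⁻ : {u v w x : Fin n} → x ∈ triple u v w → x ∈ ⁅ u ⁆ ∪ ⁅ v ⁆ ⊎ x ≡ w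
x∈triple⁻ {u = u} {v} {w} x∈ with x∈p∪q⁻ ⁅ u ⁆ (⁅ v ⁆ ∪ ⁅ w ⁆) x∈
... | inj₁ x∈u = inj₁ (x∈p∪q⁺ (inj₁ x∈u))
... | inj₂ x∈vw with x∈p∪q⁻ ⁅ v ⁆ ⁅ w ⁆ x∈vw
...   | inj₁ x∈v = inj₁ (x∈p∪q⁺ (inj₂ x∈v))
...   | inj₂ x∈w = inj₂ (x∈⁅y⁆⇒x≡y w x∈w)

w∈triple : (u v w : Fin n) → w ∈ triple u v w
w∈triple u v w = x∈p∪q⁺ (inj₂ (x∈p∪q⁺ (inj₂ (x∈⁅x⁆ w))))

Disjoint-triple : {P S : Subset n} {u v w : Fin n} →
  S ⊆ P ─ (⁅ u ⁆ ∪ ⁅ v ⁆) → w ∉ P → Disjoint S (triple u v w)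
Disjoint-triple {P = P} {S} {u} {v} {w} S⊆ w∉P (x , x∈S∩T)
  with x∈S , x∈T ← x∈p∩q⁻ S (triple u v w) x∈S∩T
  with x∈P , x∉uv ← x∈p─q⁻ P (⁅ u ⁆ ∪ ⁅ v ⁆) (S⊆ x∈S)
  with x∈triple⁻ x∈T
... | inj₁ x∈uv = x∉uv x∈uv
... | inj₂ refl = w∉P x∈P

triple-cancelʳ : {P : Subset n} {u v w w′ : Fin n} → u ∈ P → v ∈ P → w ∉ P →
  triple u v w ≡ triple u v w′ → w ≡ w′
triple-cancelʳ {P = P} {u} {v} {w} {w′} u∈P v∈P w∉P eq
  with x∈triple⁻ (subst (w ∈_) eq (w∈triple u v w))
... | inj₂ w≡w′ = w≡w′
... | inj₁ w∈uv with x∈p∪q⁻ ⁅ u ⁆ ⁅ v ⁆ w∈uv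
...   | inj₁ w∈u = contradiction (subst (_∈ P) (sym (x∈⁅y⁆⇒x≡y u w∈u)) u∈P) w∉P
...   | inj₂ w∈v = contradiction (subst (_∈ P) (sym (x∈⁅y⁆⇒x≡y v w∈v)) v∈P) w∉P

pt∈six : (h : 6 ≤ n) (k : Fin 6) → pt h k ∈ six
pt∈six h k = x∈tabulate⁺ _
  (Equivalence.to T-≡ (<⇒<ᵇ (subst (_< 6) (sym (toℕ-inject≤ k h)) (toℕ<n k))))

x∈D⁻ : (h : 6 ≤ n) (ℱ : Family n) (a b : Fin 3) {c : Fin n} → c ∈ D h ℱ a b →
  c ∉ six × triple (ptA h a) (ptB h b) c ∈F ℱ
-- In the `true` case the second component has type false ≡ true, so it is omitted.
x∈D⁻ h ℱ a b {c} c∈D with toℕ c <ᵇ 6 in c<6 | x∈tabulate⁻ _ c∈D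
... | false | T∈ℱ = c∉six , T∈ℱ
  where
  c∉six : c ∉ six
  c∉six c∈six = contradiction (trans (sym c<6) (x∈tabulate⁻ _ c∈six)) λ ()

lemma4p3 : (n : ℕ) → (h : 6 ≤ n) → (ℱ : Family n) → Uniform3 ℱ →
    AlmostIntersecting ℱ → A123 h ∈F ℱ → B456 h ∈F ℱ →
    (a b : Fin 3) → 2 ≤ ∣ D h ℱ a b ∣ →
    ∀ S → S ∈F ℱ → ¬ (S ⊆ sixMinus h a b)
lemma4p3 n h ℱ _ (_ , disjoint-unique) _ _ a b 2≤∣D∣ S S∈ℱ S⊆
  with c , c′ , c∈D , c′∈D , c≢c′ ← 2≤∣p∣⇒distinct (D h ℱ a b) 2≤∣D∣
  with c∉six , Tc∈ℱ ← x∈D⁻ h ℱ a b c∈D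
  with c′∉six , Tc′∈ℱ ← x∈D⁻ h ℱ a b c′∈D
  = c≢c′ (triple-cancelʳ (pt∈six h _) (pt∈six h _) c∉six
      (disjoint-unique S _ _ S∈ℱ Tc∈ℱ Tc′∈ℱ (Disjoint-triple S⊆ c∉six) (Disjoint-triple S⊆ c′∉six)))
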